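{- There are terms $s,t$ of Gödel's system $T$ of lowest level such that $$(\forall\Theta)\big(\mathsf{SFF}(\Theta)\to\mathsf{SCF}(t(\Theta))\big)\wedge(\forall\nu)\big(\mathsf{SCF}(\nu)\to\mathsf{SFF}(s(\nu))\big).$$
   Context: Variables $f,g,\alpha,\beta$ with "$\le1$" range over $2^{\mathbb N}$; $T\le 1$ ranges over binary trees (sets of finite binary sequences closed under initial segments, coded as type-1 objects); $\bar\alpha n=\langle\alpha(0),\dots,\alpha(n-1)\rangle$; $f\in[\sigma]$ means $\bar f|\sigma|=\sigma$. $\mathsf{SFF}(\Theta)$ for $\Theta$ of type $2\to1^*$ (finite sequences of type-1 objects): $(\forall G^2)(\forall f\le1)(\exists g\in\Theta(G))(f\in[\bar g G(g)])$. $\mathsf{SCF}(\nu)$ for $\nu$ of type $2\to(0\times1^*)$, writing $\nu(g)=(\nu(g)(1),\nu(g)(2))$: $(\forall g^2,T\le1)\big[(\forall\alpha\in\nu(g)(2))(\bar\alpha g(\alpha)\notin T)\to(\forall\beta\le1)(\exists i\le\nu(g)(1))(\bar\beta i\notin T)\big]$. -}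

module Defs where

open import Data.Nat using (ℕ; zero; suc; _≤_; _<_)
open import Data.Bool using (Bool; true; false)
open import Data.List using (List; []; _∷_; _++_; [_])
open import Data.List.Relation.Unary.All using (All)
open import Data.Product using (Σ; _×_; ∃-syntax)
open import Relation.Binary.PropositionalEquality using (_≡_)

-- Gödel's system T of lowest level (T₀): finite types over ℕ, the
-- combinators K and S at all types, zero, successor, and the recursor
-- R₀ only for recursion with values of type 0.

infixr 30 _⇒_
data Ty : Set where
  ι   : Ty
  _⇒_ : Ty → Ty → Ty

infixl 40 _·_
data Tm : Ty → Set where
  K   : ∀ {σ τ} → Tm (σ ⇒ τ ⇒ σ)
  S   : ∀ {ρ σ τ} → Tm ((ρ ⇒ σ ⇒ τ) ⇒ (ρ ⇒ σ) ⇒ ρ ⇒ τ)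
  Z   : Tm ι
  Suc : Tm (ι ⇒ ι)
  R₀  : Tm (ι ⇒ (ι ⇒ ι ⇒ ι) ⇒ ι ⇒ ι)
  _·_ : ∀ {σ τ} → Tm (σ ⇒ τ) → Tm σ → Tm τ

⟦_⟧ : Ty → Set
⟦ ι ⟧     = ℕ
⟦ σ ⇒ τ ⟧ = ⟦ σ ⟧ → ⟦ τ ⟧

rec₀ : ℕ → (ℕ → ℕ → ℕ) → ℕ → ℕ
rec₀ a f zero    = a
rec₀ a f (suc n) = f n (rec₀ a f n)

eval : ∀ {σ} → Tm σ → ⟦ σ ⟧
eval K       = λ x y → x
eval S       = λ x y z → x z (y z)
eval Z       = zero
eval Suc     = suc
eval R₀      = rec₀
eval (u · v) = eval u (eval v)

ty1 : Ty
ty1 = ι ⇒ ι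

ty2 : Ty
ty2 = ty1 ⇒ ι

-- Objects of type 2 → 1*  (a finite sequence of type-1 objects is a
-- length together with an enumeration ℕ → type 1), and 2 → (0 × 1*).

record Type2→1* : Set where
  field
    len  : ⟦ ty2 ⟧ → ℕ
    elem : ⟦ ty2 ⟧ → ℕ → (ℕ → ℕ)

record Type2→0×1* : Set where
  field
    num  : ⟦ ty2 ⟧ → ℕ
    len  : ⟦ ty2 ⟧ → ℕ
    elem : ⟦ ty2 ⟧ → ℕ → (ℕ → ℕ)

AnyIn : (n : ℕ) → (ℕ → (ℕ → ℕ)) → ((ℕ → ℕ) → Set) → Set
AnyIn n e P = Σ ℕ λ i → i < n × P (e i)

AllIn : (n : ℕ) → (ℕ → (ℕ → ℕ)) → ((ℕ → ℕ) → Set) → Set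
AllIn n e P = ∀ i → i < n → P (e i)

Bin : (ℕ → ℕ) → Set
Bin f = ∀ n → f n ≤ 1

bar : (ℕ → ℕ) → ℕ → List ℕ
bar α zero    = []
bar α (suc n) = bar α n ++ [ α n ]

InCyl : (ℕ → ℕ) → (ℕ → ℕ) → ℕ → Set
InCyl f g k = bar f k ≡ bar g k

IsBinTree : (List ℕ → Bool) → Set
IsBinTree T = (∀ σ τ → T (σ ++ τ) ≡ true → T σ ≡ true)
            × (∀ σ → T σ ≡ true → All (_≤ 1) σ)

SFF : Type2→1* → Set
SFF Θ = ∀ (G : ⟦ ty2 ⟧) (f : ℕ → ℕ) → Bin f →
        AnyIn (len G) (elem G) (λ g → InCyl f g (G g))
  where open Type2→1* Θ

SCF : Type2→0×1* → Set
SCF ν = ∀ (g : ⟦ ty2 ⟧) (T : List ℕ → Bool) → IsBinTree T →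
        AllIn (len g) (elem g) (λ α → T (bar α (g α)) ≡ false) →
        ∀ (β : ℕ → ℕ) → Bin β →
        Σ ℕ λ i → i ≤ num g × T (bar β i) ≡ false
  where open Type2→0×1* ν

tyΘlen : Ty
tyΘlen = ty2 ⇒ ι

tyΘelem : Ty
tyΘelem = ty2 ⇒ ι ⇒ ty1

-- t : (2→1*) → (2→(0×1*)), given as three T₀ terms
record TermT : Set where
  field
    tnum  : Tm (tyΘlen ⇒ tyΘelem ⇒ ty2 ⇒ ι)
    tlen  : Tm (tyΘlen ⇒ tyΘelem ⇒ ty2 ⇒ ι)
    telem : Tm (tyΘlen ⇒ tyΘelem ⇒ ty2 ⇒ ι ⇒ ty1)

-- s : (2→(0×1*)) → (2→1*), given as two T₀ terms
record TermS : Set where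
  field
    slen  : Tm (tyΘlen ⇒ tyΘlen ⇒ tyΘelem ⇒ ty2 ⇒ ι)
    selem : Tm (tyΘlen ⇒ tyΘlen ⇒ tyΘelem ⇒ ty2 ⇒ ι ⇒ ty1)

applyT : TermT → Type2→1* → Type2→0×1*
applyT t Θ = record
  { num  = eval (TermT.tnum t)  (Type2→1*.len Θ) (Type2→1*.elem Θ)
  ; len  = eval (TermT.tlen t)  (Type2→1*.len Θ) (Type2→1*.elem Θ)
  ; elem = eval (TermT.telem t) (Type2→1*.len Θ) (Type2→1*.elem Θ)
  }

applyS : TermS → Type2→0×1* → Type2→1*
applyS s ν = record
  { len  = eval (TermS.slen s)  (Type2→0×1*.num ν) (Type2→0×1*.len ν) (Type2→0×1*.elem ν)
  ; elem = eval (TermS.selem s) (Type2→0×1*.num ν) (Type2→0×1*.len ν) (Type2→0×1*.elem ν)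
  }

-- Given Θ with SFF(Θ), the SCF realiser keeps the sequence Θ(g) and takes
-- as bound the sum of the numbers g(gᵢ): for binary β, SFF puts β in some
-- cylinder [ḡᵢ g(gᵢ)], whose stem is outside T, so β̄ (g(gᵢ)) ∉ T.
-- Conversely, given ν with SCF(ν), G and binary f, apply SCF to the tree of
-- binary sequences that extend none of the stems ḡ G(g), g ∈ ν(G)(2); the
-- node f̄ i leaving that tree is binary, hence extends one of those stems,
-- and this places f in the corresponding cylinder. Both translations only
-- use recursion of type 0, so they are given by terms of T₀.
module Submission where

open import Defs
open import Data.Bool using (Bool; true; false)
open import Data.List using (List; []; _∷_; _++_; [_]; applyUpTo)
open import Data.List.Properties using (applyUpTo-∷ʳ)
open import Data.List.Relation.Unary.All using (All; all?)
open import Data.List.Relation.Unary.All.Properties using (++⁻ˡ; applyUpTo⁺₂)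
open import Data.List.Relation.Binary.Pointwise as Pointwise using ()
open import Data.List.Relation.Binary.Prefix.Heterogeneous using (Prefix; []; _∷_; _++ᵖ_)
open import Data.List.Relation.Binary.Prefix.Heterogeneous.Properties using (fromPointwise; prefix?)
open import Data.Nat using (ℕ; zero; suc; _+_; _≤_; _<_; _≤?_; _≟_)
open import Data.Nat.Properties using (≤-trans; m≤m+n; m≤n+m; m<1+n⇒m<n∨m≡n; anyUpTo?)
open import Data.Product using (Σ; ∃; _×_; _,_; proj₁)
open import Data.Sum using (inj₁; inj₂)
open import Relation.Binary.PropositionalEquality
  using (_≡_; refl; sym; trans; cong; cong₂; subst)
open import Relation.Nullary using (Dec; yes; no; does; ¬_; ¬?; _×-dec_)
open import Relation.Nullary.Decidable using (dec-true; dec-false; decidable-stable)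
open import Relation.Unary using (Decidable)

private
  variable
    Γ : List Ty
    ρ σ τ : Ty

data _∋_ : List Ty → Ty → Set where
  here  : (σ ∷ Γ) ∋ σ
  there : Γ ∋ σ → (τ ∷ Γ) ∋ σ

infixl 40 _$_
data Exp (Γ : List Ty) : Ty → Set where
  var : Γ ∋ σ → Exp Γ σ
  con : Tm σ → Exp Γ σ
  _$_ : Exp Γ (σ ⇒ τ) → Exp Γ σ → Exp Γ τ

I : Tm (σ ⇒ σ)
I {σ} = S · K · K {σ} {ι}

ƛ : Exp (σ ∷ Γ) τ → Exp Γ (σ ⇒ τ)
ƛ (var here)      = con I
ƛ (var (there x)) = con K $ var x
ƛ (con c)         = con (K · c)
ƛ (u $ v)         = con S $ ƛ u $ ƛ v

closed : Exp [] σ → Tm σ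
closed (con c) = c
closed (u $ v) = closed u · closed v

#0 : Exp (σ ∷ Γ) σ
#0 = var here

#1 : Exp (τ ∷ σ ∷ Γ) σ
#1 = var (there here)

#2 : Exp (ρ ∷ τ ∷ σ ∷ Γ) σ
#2 = var (there (there here))

#3 : ∀ {υ} → Exp (υ ∷ ρ ∷ τ ∷ σ ∷ Γ) σ
#3 = var (there (there (there here)))

-- Recursion on the second argument, so that R₀ realises it definitionally.
_+₀_ : ℕ → ℕ → ℕ
m +₀ n = rec₀ m (λ _ → suc) n

sumBelow : (ℕ → ℕ) → ℕ → ℕ
sumBelow h = rec₀ 0 (λ k s → h k +₀ s)

+₀≡+ : ∀ m n → m +₀ n ≡ n + m
+₀≡+ m zero    = refl
+₀≡+ m (suc n) = cong suc (+₀≡+ m n)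

≤-sumBelow : ∀ h {n k} → k < n → h k ≤ sumBelow h n
≤-sumBelow h {suc n} k<1+n rewrite +₀≡+ (h n) (sumBelow h n)
  with m<1+n⇒m<n∨m≡n k<1+n
... | inj₁ k<n  = ≤-trans (≤-sumBelow h k<n) (m≤m+n _ _)
... | inj₂ refl = m≤n+m _ _

bar≡applyUpTo : ∀ f n → bar f n ≡ applyUpTo f n
bar≡applyUpTo f zero    = refl
bar≡applyUpTo f (suc n) =
  trans (cong (_++ [ f n ]) (bar≡applyUpTo f n)) (applyUpTo-∷ʳ f n)

bar-binary : ∀ {f} → Bin f → ∀ n → All (_≤ 1) (bar f n)
bar-binary {f} binf n rewrite bar≡applyUpTo f n = applyUpTo⁺₂ f n binf

applyUpTo-prefix⇒≡ : ∀ (f g : ℕ → ℕ) m {i} →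
  Prefix _≡_ (applyUpTo g m) (applyUpTo f i) → applyUpTo f m ≡ applyUpTo g m
applyUpTo-prefix⇒≡ f g zero    _          = refl
applyUpTo-prefix⇒≡ f g (suc m) {suc i} (g0≡f0 ∷ p) =
  cong₂ _∷_ (sym g0≡f0) (applyUpTo-prefix⇒≡ (λ k → f (suc k)) (λ k → g (suc k)) m p)

prefix-bar⇒InCyl : ∀ f g m {i} → Prefix _≡_ (bar g m) (bar f i) → InCyl f g m
prefix-bar⇒InCyl f g m {i} p
  rewrite bar≡applyUpTo f m | bar≡applyUpTo g m | bar≡applyUpTo f i =
  applyUpTo-prefix⇒≡ f g m p

does-true : ∀ {a} {A : Set a} (a? : Dec A) → does a? ≡ true → A
does-true (yes a) _ = a

does-false : ∀ {a} {A : Set a} (a? : Dec A) → does a? ≡ false → ¬ A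
does-false (no ¬a) _ = ¬a

ExtendsOneOf : ℕ → (ℕ → List ℕ) → List ℕ → Set
ExtendsOneOf n stem s = ∃ λ k → k < n × Prefix _≡_ (stem k) s

extendsOneOf? : ∀ n stem → Decidable (ExtendsOneOf n stem)
extendsOneOf? n stem s = anyUpTo? (λ k → prefix? _≟_ (stem k) s) n

avoiding? : ∀ n stem s → Dec (All (_≤ 1) s × ¬ ExtendsOneOf n stem s)
avoiding? n stem s = all? (_≤? 1) s ×-dec ¬? (extendsOneOf? n stem s)

avoiding : ℕ → (ℕ → List ℕ) → List ℕ → Bool
avoiding n stem s = does (avoiding? n stem s)

avoiding-isBinTree : ∀ n stem → IsBinTree (avoiding n stem)
avoiding-isBinTree n stem = closed-under-prefix , binary
  where
  closed-under-prefix : ∀ s t → avoiding n stem (s ++ t) ≡ true → avoiding n stem s ≡ true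
  closed-under-prefix s t st∈T with does-true (avoiding? n stem (s ++ t)) st∈T
  ... | bin , ¬ext =
    dec-true (avoiding? n stem s) (++⁻ˡ s bin , λ (k , k<n , p) → ¬ext (k , k<n , p ++ᵖ t))

  binary : ∀ s → avoiding n stem s ≡ true → All (_≤ 1) s
  binary s s∈T = proj₁ (does-true (avoiding? n stem s) s∈T)

avoiding-stem : ∀ {n} stem {k} → k < n → avoiding n stem (stem k) ≡ false
avoiding-stem {n} stem {k} k<n =
  dec-false (avoiding? n stem (stem k))
    (λ (_ , ¬ext) → ¬ext (k , k<n , fromPointwise (Pointwise.refl refl)))

binary-not-avoiding : ∀ {n stem s} → All (_≤ 1) s →
  avoiding n stem s ≡ false → ExtendsOneOf n stem s
binary-not-avoiding {n} {stem} {s} bin s∉T =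
  decidable-stable (extendsOneOf? n stem s)
    (λ ¬ext → does-false (avoiding? n stem s) s∉T (bin , ¬ext))

toSCF : Type2→1* → Type2→0×1*
toSCF Θ = record
  { num  = λ g → sumBelow (λ k → g (elem g k)) (len g)
  ; len  = len
  ; elem = elem
  }
  where open Type2→1* Θ

toSFF : Type2→0×1* → Type2→1*
toSFF ν = record { len = len ; elem = elem }
  where open Type2→0×1* ν

SFF⇒SCF : ∀ Θ → SFF Θ → SCF (toSCF Θ)
SFF⇒SCF Θ sff g T _ stems∉T β binβ with sff g β binβ
... | k , k<len , β∈cyl =
  g (elem g k) , ≤-sumBelow _ k<len , trans (cong T β∈cyl) (stems∉T k k<len)
  where open Type2→1* Θ

SCF⇒SFF : ∀ ν → SCF ν → SFF (toSFF ν)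
SCF⇒SFF ν scf G f binf = f-in-some-cylinder
  where
  open Type2→0×1* ν

  stem : ℕ → List ℕ
  stem k = bar (elem G k) (G (elem G k))

  f-in-some-cylinder : AnyIn (len G) (elem G) (λ g → InCyl f g (G g))
  f-in-some-cylinder
    with scf G (avoiding (len G) stem) (avoiding-isBinTree (len G) stem)
             (λ k k<len → avoiding-stem stem k<len) f binf
  ... | i , _ , f̄i∉T with binary-not-avoiding (bar-binary binf i) f̄i∉T
  ...   | k , k<len , p = k , k<len , prefix-bar⇒InCyl f (elem G k) (G (elem G k)) {i} p

sT : TermS
sT = record
  { slen  = closed (ƛ (ƛ (ƛ (ƛ (#2 $ #0)))))
  ; selem = closed (ƛ (ƛ (ƛ (ƛ (#1 $ #0)))))
  }

-- tnum is λ L E g → R₀ 0 (λ k s → g (E g k) +₀ s) (L g), in de Bruijn notation.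
tT : TermT
tT = record
  { tnum  = closed (ƛ (ƛ (ƛ (con R₀ $ con Z $ ƛ (ƛ (plus (#2 $ (#3 $ #2 $ #1)) #0)) $ (#2 $ #0)))))
  ; tlen  = closed (ƛ (ƛ (ƛ (#2 $ #0))))
  ; telem = closed (ƛ (ƛ (ƛ (#1 $ #0))))
  }
  where
  plus : Exp Γ ι → Exp Γ ι → Exp Γ ι
  plus a b = con R₀ $ a $ con (K · Suc) $ b

applyS-sT : ∀ ν → applyS sT ν ≡ toSFF ν
applyS-sT ν = refl

applyT-tT : ∀ Θ → applyT tT Θ ≡ toSCF Θ
applyT-tT Θ = refl

theorem2p23 : Σ TermS λ s → Σ TermT λ t →
                  (∀ (Θ : Type2→1*) → SFF Θ → SCF (applyT t Θ))
                × (∀ (ν : Type2→0×1*) → SCF ν → SFF (applyS s ν))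
theorem2p23 =
  sT , tT ,
  (λ Θ sff → subst SCF (sym (applyT-tT Θ)) (SFF⇒SCF Θ sff)) ,
  (λ ν scf → subst SFF (sym (applyS-sT ν)) (SCF⇒SFF ν scf))
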